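{- Let $q=p^s$ be a prime power. Let $R,S\in\mathbb{F}_q[x]$ be non-constant polynomials each with constant term $1$. Suppose that $R$ and its derivative $R'$ are relatively prime, $m,n\ge2$ are integers, $k=q-mn>0$, $\deg R=n-1$, and $\deg S=k-l$ for some integer $0\le l\le k$. If one of the following conditions is satisfied: (1) every integer between $m$ and $m+\lfloor\frac{k-l}{n-1}\rfloor$ (inclusive) is not a multiple of $p$; (2) $p\nmid(m+l)$; then $x^{\deg R+\deg S+1}$ does not divide $R^m(x)S(x)-1$. -}

module Defs where

open import Level using (Level; _⊔_)
open import Algebra.Bundles using (CommutativeRing)
open import Data.Nat using (ℕ; zero; suc; _<_; _/_)
open import Data.Fin using (Fin)
open import Data.List using (List; []; _∷_; map; replicate; _++_)
open import Data.Product using (Σ; ∃; _×_)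
open import Relation.Binary.PropositionalEquality using (_≡_)
open import Relation.Nullary using (¬_)

-- Floor division ⌊a / b⌋ on naturals (only ever used with b ≥ 1; b = 0 gives 0).
floorDiv : ℕ → ℕ → ℕ
floorDiv a zero    = 0
floorDiv a (suc b) = a / suc b

record IsField {c ℓ : Level} (F : CommutativeRing c ℓ) : Set (c ⊔ ℓ) where
  open CommutativeRing F
  field
    1≉0     : ¬ (1# ≈ 0#)
    inverse : ∀ x → ¬ (x ≈ 0#) → ∃ λ y → (x * y) ≈ 1#

HasSize : {c ℓ : Level} (F : CommutativeRing c ℓ) → ℕ → Set (c ⊔ ℓ)
HasSize F q = Σ (Fin q → Carrier) λ e →
                (∀ i j → e i ≈ e j → i ≡ j) × (∀ x → ∃ λ i → e i ≈ x)
  where open CommutativeRing F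

-- Univariate polynomials over a commutative ring, as coefficient lists
-- (lowest degree first; trailing zero coefficients are allowed).
module Poly {c ℓ : Level} (F : CommutativeRing c ℓ) where
  open CommutativeRing F

  Pol : Set c
  Pol = List Carrier

  coeff : Pol → ℕ → Carrier
  coeff []      _       = 0#
  coeff (a ∷ f) zero    = a
  coeff (a ∷ f) (suc i) = coeff f i

  _≈ₚ_ : Pol → Pol → Set ℓ
  f ≈ₚ g = ∀ i → coeff f i ≈ coeff g i

  constP : Carrier → Pol
  constP a = a ∷ []

  oneP : Pol
  oneP = constP 1#

  xPow : ℕ → Pol
  xPow N = replicate N 0# ++ (1# ∷ [])

  addP : Pol → Pol → Pol
  addP []      g       = g
  addP (a ∷ f) []      = a ∷ f
  addP (a ∷ f) (b ∷ g) = (a + b) ∷ addP f g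

  negP : Pol → Pol
  negP = map (-_)

  subP : Pol → Pol → Pol
  subP f g = addP f (negP g)

  scaleP : Carrier → Pol → Pol
  scaleP a = map (a *_)

  mulP : Pol → Pol → Pol
  mulP []      g = []
  mulP (a ∷ f) g = addP (scaleP a g) (0# ∷ mulP f g)

  powP : Pol → ℕ → Pol
  powP f zero    = oneP
  powP f (suc k) = mulP f (powP f k)

  natR : ℕ → Carrier
  natR zero    = 0#
  natR (suc i) = 1# + natR i

  derivAux : ℕ → Pol → Pol
  derivAux i []      = []
  derivAux i (b ∷ f) = (natR i * b) ∷ derivAux (suc i) f

  deriv : Pol → Pol
  deriv []      = []
  deriv (a ∷ f) = derivAux 1 f

  DividesP : Pol → Pol → Set (c ⊔ ℓ)
  DividesP d f = ∃ λ e → f ≈ₚ mulP d e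

  IsUnitP : Pol → Set (c ⊔ ℓ)
  IsUnitP f = ∃ λ g → mulP f g ≈ₚ oneP

  CoprimeP : Pol → Pol → Set (c ⊔ ℓ)
  CoprimeP f g = ∀ d → DividesP d f → DividesP d g → IsUnitP d

  HasDegree : Pol → ℕ → Set ℓ
  HasDegree f d = ¬ (coeff f d ≈ 0#) × (∀ i → d < i → coeff f i ≈ 0#)

  NonConstant : Pol → Set ℓ
  NonConstant f = ∃ λ d → (0 < d) × HasDegree f d

  ConstTermOne : Pol → Set ℓ
  ConstTermOne f = coeff f 0 ≈ 1#

{-# OPTIONS --safe #-}
module Submission where

-- Put P = R^m S, D = deg R and E = deg S. If x^(D+E+1) divides P - 1, then
-- P' = R^(m-1) (m R' S + R S') vanishes below x^(D+E); since R(0) = 1 the bracket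
-- does too, and having degree < D + E it is zero. Its top coefficient is
-- (m D + E) · lead R · lead S, and m D + E + (m + l) = q is 0 in F, so p ∣ m + l.
-- Under condition (1) one descends instead: if (m + j) R' U + R U' = 0 with
-- p ∤ m + j, then R ∣ U because gcd(R, R') = 1, and U = R U₂ satisfies
-- (m + j + 1) R' U₂ + R U₂' = 0. Starting from U = S, each step lowers deg U by D,
-- and p ∤ m + j is guaranteed for every j ≤ E / D, so the descent would never stop.

open import Defs
open import Level using (Level)
open import Algebra.Bundles using (CommutativeRing; CommutativeMonoid)
import Algebra.Definitions.RawMonoid as RawMonoidDefinitions
import Algebra.Properties.CommutativeMonoid.Sum as SumProperties
import Algebra.Properties.Ring as RingProperties
import Algebra.Solver.Ring.NaturalCoefficients.Default as CommutativeSemiringSolver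
open import Data.Empty using (⊥; ⊥-elim)
open import Data.Fin using (Fin)
import Data.Fin.Properties as Finₚ
open import Data.Fin.Permutation using (Permutation; permutation)
open import Data.List using ([]; _∷_; replicate; _++_; length)
open import Data.Nat as ℕ using (ℕ; zero; suc; _∸_; _≤_; _<_; z≤n; s≤s)
open import Data.Nat.Coprimality using (Coprime; coprime-Bézout)
open import Data.Nat.Divisibility using (_∣_)
import Data.Nat.DivMod as DivMod
open import Data.Nat.GCD using (module Bézout)
open import Data.Nat.Induction using (<-wellFounded)
open import Data.Nat.Primality using (Prime; prime⇒irreducible)
import Data.Nat.Properties as ℕₚ
open import Data.Product using (Σ; ∃; _×_; _,_; proj₁; proj₂)
open import Data.Sum using (_⊎_; inj₁; inj₂)
open import Induction.WellFounded using (Acc; acc)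
open import Relation.Binary.Bundles using (Setoid)
open import Relation.Binary.Definitions using (Decidable; tri<; tri≈; tri>)
open import Relation.Binary.PropositionalEquality as ≡ using (_≡_)
import Relation.Binary.Reasoning.Setoid as SetoidReasoning
open import Relation.Nullary using (¬_; yes; no)

module PolynomialRing {c ℓ : Level} (F : CommutativeRing c ℓ) where
  open CommutativeRing F hiding (zero)
  open Poly F
  open RingProperties ring using (-0#≈0#)
  open CommutativeSemiringSolver commutativeSemiring using (solve; _:=_; _:+_; _:*_)

  -- A record rather than Defs' function type _≈ₚ_, so that both polynomials
  -- can be inferred from a proof of f ≃ g.
  infix 4 _≃_
  record _≃_ (f g : Pol) : Set ℓ where
    constructor coeffwise
    field at : ∀ i → coeff f i ≈ coeff g i
  open _≃_ public

  ≃-refl : ∀ {f} → f ≃ f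
  ≃-refl = coeffwise λ i → refl

  ≃-sym : ∀ {f g} → f ≃ g → g ≃ f
  ≃-sym e = coeffwise λ i → sym (at e i)

  ≃-trans : ∀ {f g h} → f ≃ g → g ≃ h → f ≃ h
  ≃-trans e e' = coeffwise λ i → trans (at e i) (at e' i)

  ≃-setoid : Setoid c ℓ
  ≃-setoid = record { Carrier = Pol ; _≈_ = _≃_ ; isEquivalence = record { refl = ≃-refl ; sym = ≃-sym ; trans = ≃-trans } }

  ∷-cong : ∀ {a b f g} → a ≈ b → f ≃ g → (a ∷ f) ≃ (b ∷ g)
  ∷-cong a≈b f≃g = coeffwise λ { zero → a≈b ; (suc i) → at f≃g i }

  ∷-tail : ∀ {a b f g} → (a ∷ f) ≃ (b ∷ g) → f ≃ g
  ∷-tail e = coeffwise λ i → at e (suc i)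

  0∷-≃[] : ∀ {f} → f ≃ [] → (0# ∷ f) ≃ []
  0∷-≃[] e = coeffwise λ { zero → refl ; (suc i) → at e i }

  coeff-addP : ∀ f g i → coeff (addP f g) i ≈ coeff f i + coeff g i
  coeff-addP []      g       i       = sym (+-identityˡ _)
  coeff-addP (a ∷ f) []      i       = sym (+-identityʳ _)
  coeff-addP (a ∷ f) (b ∷ g) zero    = refl
  coeff-addP (a ∷ f) (b ∷ g) (suc i) = coeff-addP f g i

  coeff-scaleP : ∀ a f i → coeff (scaleP a f) i ≈ a * coeff f i
  coeff-scaleP a []      i       = sym (zeroʳ a)
  coeff-scaleP a (b ∷ f) zero    = refl
  coeff-scaleP a (b ∷ f) (suc i) = coeff-scaleP a f i

  coeff-negP : ∀ f i → coeff (negP f) i ≈ - coeff f i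
  coeff-negP []      i       = sym -0#≈0#
  coeff-negP (b ∷ f) zero    = refl
  coeff-negP (b ∷ f) (suc i) = coeff-negP f i

  coeff-mulP-∷ : ∀ a f g i → coeff (mulP (a ∷ f) g) i ≈ a * coeff g i + coeff (0# ∷ mulP f g) i
  coeff-mulP-∷ a f g i = trans (coeff-addP (scaleP a g) (0# ∷ mulP f g) i) (+-congʳ (coeff-scaleP a g i))

  addP-cong : ∀ {f f' g g'} → f ≃ f' → g ≃ g' → addP f g ≃ addP f' g'
  addP-cong {f} {f'} {g} {g'} e e' = coeffwise λ i →
    trans (coeff-addP f g i) (trans (+-cong (at e i) (at e' i)) (sym (coeff-addP f' g' i)))

  scaleP-cong : ∀ {a b f g} → a ≈ b → f ≃ g → scaleP a f ≃ scaleP b g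
  scaleP-cong {a} {b} {f} {g} a≈b e = coeffwise λ i →
    trans (coeff-scaleP a f i) (trans (*-cong a≈b (at e i)) (sym (coeff-scaleP b g i)))

  negP-cong : ∀ {f g} → f ≃ g → negP f ≃ negP g
  negP-cong {f} {g} e = coeffwise λ i →
    trans (coeff-negP f i) (trans (-‿cong (at e i)) (sym (coeff-negP g i)))

  addP-comm : ∀ f g → addP f g ≃ addP g f
  addP-comm f g = coeffwise λ i →
    trans (coeff-addP f g i) (trans (+-comm _ _) (sym (coeff-addP g f i)))

  addP-assoc : ∀ f g h → addP (addP f g) h ≃ addP f (addP g h)
  addP-assoc f g h = coeffwise λ i → begin
    coeff (addP (addP f g) h) i         ≈⟨ trans (coeff-addP (addP f g) h i) (+-congʳ (coeff-addP f g i)) ⟩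
    (coeff f i + coeff g i) + coeff h i ≈⟨ +-assoc _ _ _ ⟩
    coeff f i + (coeff g i + coeff h i) ≈⟨ sym (trans (coeff-addP f (addP g h) i) (+-congˡ (coeff-addP g h i))) ⟩
    coeff (addP f (addP g h)) i         ∎
    where open SetoidReasoning setoid

  addP-identityʳ : ∀ f → addP f [] ≃ f
  addP-identityʳ f = coeffwise λ i → trans (coeff-addP f [] i) (+-identityʳ _)

  addP-inverseʳ : ∀ f → addP f (negP f) ≃ []
  addP-inverseʳ f = coeffwise λ i →
    trans (coeff-addP f (negP f) i) (trans (+-congˡ (coeff-negP f i)) (-‿inverseʳ _))

  addP-interchange : ∀ f g h k → addP (addP f g) (addP h k) ≃ addP (addP f h) (addP g k)
  addP-interchange f g h k = coeffwise λ i → begin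
    coeff (addP (addP f g) (addP h k)) i
      ≈⟨ trans (coeff-addP (addP f g) (addP h k) i) (+-cong (coeff-addP f g i) (coeff-addP h k i)) ⟩
    (coeff f i + coeff g i) + (coeff h i + coeff k i)
      ≈⟨ solve 4 (λ x y z w → (x :+ y) :+ (z :+ w) := (x :+ z) :+ (y :+ w)) refl _ _ _ _ ⟩
    (coeff f i + coeff h i) + (coeff g i + coeff k i)
      ≈⟨ sym (trans (coeff-addP (addP f h) (addP g k) i) (+-cong (coeff-addP f h i) (coeff-addP g k i))) ⟩
    coeff (addP (addP f h) (addP g k)) i ∎
    where open SetoidReasoning setoid

  scaleP-distribʳ : ∀ a b f → scaleP (a + b) f ≃ addP (scaleP a f) (scaleP b f)
  scaleP-distribʳ a b f = coeffwise λ i →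
    trans (coeff-scaleP (a + b) f i) (trans (distribʳ _ a b)
      (sym (trans (coeff-addP (scaleP a f) (scaleP b f) i) (+-cong (coeff-scaleP a f i) (coeff-scaleP b f i)))))

  scaleP-distribˡ : ∀ a f g → scaleP a (addP f g) ≃ addP (scaleP a f) (scaleP a g)
  scaleP-distribˡ a f g = coeffwise λ i →
    trans (coeff-scaleP a (addP f g) i) (trans (*-congˡ (coeff-addP f g i)) (trans (distribˡ a _ _)
      (sym (trans (coeff-addP (scaleP a f) (scaleP a g) i) (+-cong (coeff-scaleP a f i) (coeff-scaleP a g i))))))

  scaleP-assoc : ∀ a b f → scaleP a (scaleP b f) ≃ scaleP (a * b) f
  scaleP-assoc a b f = coeffwise λ i →
    trans (coeff-scaleP a (scaleP b f) i) (trans (*-congˡ (coeff-scaleP b f i))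
      (trans (sym (*-assoc _ _ _)) (sym (coeff-scaleP (a * b) f i))))

  scaleP-zero : ∀ f → scaleP 0# f ≃ []
  scaleP-zero f = coeffwise λ i → trans (coeff-scaleP 0# f i) (zeroˡ _)

  scaleP-identity : ∀ f → scaleP 1# f ≃ f
  scaleP-identity f = coeffwise λ i → trans (coeff-scaleP 1# f i) (*-identityˡ _)

  mulP-≃[]ˡ : ∀ f g → f ≃ [] → mulP f g ≃ []
  mulP-≃[]ˡ []      g e = ≃-refl
  mulP-≃[]ˡ (a ∷ f) g e = coeffwise λ i →
    trans (coeff-mulP-∷ a f g i)
      (trans (+-cong (trans (*-congʳ (at e zero)) (zeroˡ _)) (at (0∷-≃[] (mulP-≃[]ˡ f g (coeffwise λ j → at e (suc j)))) i))
             (+-identityʳ 0#))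

  mulP-zeroʳ : ∀ f → mulP f [] ≃ []
  mulP-zeroʳ []      = ≃-refl
  mulP-zeroʳ (a ∷ f) = 0∷-≃[] (mulP-zeroʳ f)

  mulP-congˡ : ∀ {f f'} g → f ≃ f' → mulP f g ≃ mulP f' g
  mulP-congˡ {[]}    {[]}     g e = ≃-refl
  mulP-congˡ {[]}    {b ∷ f'} g e = ≃-sym (mulP-≃[]ˡ (b ∷ f') g (≃-sym e))
  mulP-congˡ {a ∷ f} {[]}     g e = mulP-≃[]ˡ (a ∷ f) g e
  mulP-congˡ {a ∷ f} {b ∷ f'} g e =
    addP-cong (scaleP-cong (at e zero) ≃-refl) (∷-cong refl (mulP-congˡ g (∷-tail e)))

  mulP-congʳ : ∀ f {g g'} → g ≃ g' → mulP f g ≃ mulP f g'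
  mulP-congʳ []      e = ≃-refl
  mulP-congʳ (a ∷ f) e = addP-cong (scaleP-cong refl e) (∷-cong refl (mulP-congʳ f e))

  mulP-cong : ∀ {f f' g g'} → f ≃ f' → g ≃ g' → mulP f g ≃ mulP f' g'
  mulP-cong {f} {f'} {g} e e' = ≃-trans (mulP-congˡ g e) (mulP-congʳ f' e')

  mulP-distribʳ : ∀ f g h → mulP (addP f g) h ≃ addP (mulP f h) (mulP g h)
  mulP-distribʳ []      g       h = ≃-refl
  mulP-distribʳ (a ∷ f) []      h = ≃-sym (addP-identityʳ _)
  mulP-distribʳ (a ∷ f) (b ∷ g) h =
    ≃-trans (addP-cong (scaleP-distribʳ a b h) (∷-cong (sym (+-identityʳ 0#)) (mulP-distribʳ f g h)))
            (addP-interchange (scaleP a h) (scaleP b h) (0# ∷ mulP f h) (0# ∷ mulP g h))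

  scaleP-mulPˡ : ∀ a g h → mulP (scaleP a g) h ≃ scaleP a (mulP g h)
  scaleP-mulPˡ a []      h = ≃-refl
  scaleP-mulPˡ a (b ∷ g) h =
    ≃-trans (addP-cong (≃-sym (scaleP-assoc a b h)) (∷-cong (sym (zeroʳ a)) (scaleP-mulPˡ a g h)))
            (≃-sym (scaleP-distribˡ a (scaleP b h) (0# ∷ mulP g h)))

  mulP-identityˡ : ∀ g → mulP oneP g ≃ g
  mulP-identityˡ g = ≃-trans (addP-cong (scaleP-identity g) (0∷-≃[] ≃-refl)) (addP-identityʳ g)

  mulP-∷ʳ : ∀ g a f → mulP g (a ∷ f) ≃ addP (scaleP a g) (0# ∷ mulP g f)
  mulP-∷ʳ []      a f = ≃-sym (0∷-≃[] ≃-refl)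
  mulP-∷ʳ (b ∷ g) a f = ∷-cong (+-congʳ (*-comm b a)) (begin
    addP (scaleP b f) (mulP g (a ∷ f))
      ≈⟨ addP-cong ≃-refl (mulP-∷ʳ g a f) ⟩
    addP (scaleP b f) (addP (scaleP a g) (0# ∷ mulP g f))
      ≈⟨ ≃-sym (addP-assoc (scaleP b f) (scaleP a g) (0# ∷ mulP g f)) ⟩
    addP (addP (scaleP b f) (scaleP a g)) (0# ∷ mulP g f)
      ≈⟨ addP-cong (addP-comm (scaleP b f) (scaleP a g)) ≃-refl ⟩
    addP (addP (scaleP a g) (scaleP b f)) (0# ∷ mulP g f)
      ≈⟨ addP-assoc (scaleP a g) (scaleP b f) (0# ∷ mulP g f) ⟩
    addP (scaleP a g) (mulP (b ∷ g) f) ∎)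
    where open SetoidReasoning ≃-setoid

  mulP-comm : ∀ f g → mulP f g ≃ mulP g f
  mulP-comm []      g = ≃-sym (mulP-zeroʳ g)
  mulP-comm (a ∷ f) g = ≃-trans (addP-cong ≃-refl (∷-cong refl (mulP-comm f g))) (≃-sym (mulP-∷ʳ g a f))

  mulP-assoc : ∀ f g h → mulP (mulP f g) h ≃ mulP f (mulP g h)
  mulP-assoc []      g h = ≃-refl
  mulP-assoc (a ∷ f) g h =
    ≃-trans (mulP-distribʳ (scaleP a g) (0# ∷ mulP f g) h)
            (addP-cong (scaleP-mulPˡ a g h)
                       (≃-trans (addP-cong (scaleP-zero h) ≃-refl) (∷-cong refl (mulP-assoc f g h))))

  polyRing : CommutativeRing c ℓ
  polyRing = record
    { Carrier = Pol ; _≈_ = _≃_ ; _+_ = addP ; _*_ = mulP ; -_ = negP ; 0# = [] ; 1# = oneP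
    ; isCommutativeRing = record
      { isRing = record
        { +-isAbelianGroup = record
          { isGroup = record
            { isMonoid = record
              { isSemigroup = record
                { isMagma = record
                  { isEquivalence = Setoid.isEquivalence ≃-setoid
                  ; ∙-cong = addP-cong }
                ; assoc = addP-assoc }
              ; identity = (λ f → ≃-refl) , addP-identityʳ }
            ; inverse = (λ f → ≃-trans (addP-comm (negP f) f) (addP-inverseʳ f)) , addP-inverseʳ
            ; ⁻¹-cong = negP-cong }
          ; comm = addP-comm }
        ; *-cong = mulP-cong
        ; *-assoc = mulP-assoc
        ; *-identity = mulP-identityˡ , (λ f → ≃-trans (mulP-comm f oneP) (mulP-identityˡ f))
        ; distrib = (λ f g h → ≃-trans (mulP-comm f (addP g h))
                                 (≃-trans (mulP-distribʳ g h f) (addP-cong (mulP-comm g f) (mulP-comm h f))))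
                    , (λ f g h → mulP-distribʳ g h f) }
      ; *-comm = mulP-comm } }

prime∤⇒coprime : ∀ {p n} → Prime p → ¬ p ∣ n → Coprime p n
prime∤⇒coprime p-prime p∤n (d∣p , d∣n) with prime⇒irreducible p-prime d∣p
... | inj₁ d≡1    = d≡1
... | inj₂ ≡.refl = ⊥-elim (p∤n d∣n)

module Characteristic {c ℓ : Level} (F : CommutativeRing c ℓ) where
  open CommutativeRing F hiding (zero)
  open Poly F using (natR)

  natR-+ : ∀ a b → natR (a ℕ.+ b) ≈ natR a + natR b
  natR-+ zero    b = sym (+-identityˡ _)
  natR-+ (suc a) b = trans (+-congˡ (natR-+ a b)) (sym (+-assoc _ _ _))

  natR-* : ∀ a b → natR (a ℕ.* b) ≈ natR a * natR b
  natR-* zero    b = sym (zeroˡ _)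
  natR-* (suc a) b = trans (natR-+ b (a ℕ.* b)) (trans (+-congˡ (natR-* a b))
    (sym (trans (distribʳ (natR b) 1# (natR a)) (+-congʳ (*-identityˡ (natR b))))))

  natR-suc-* : ∀ n a → natR (suc n) * a ≈ a + natR n * a
  natR-suc-* n a = trans (distribʳ a 1# (natR n)) (+-congʳ (*-identityˡ a))

  -- Bézout: 1 + y N = x p or 1 + x p = y N, and both natR (y N) and natR (x p) annihilate a.
  natR-*-cancel : ∀ {p N} → Coprime p N → natR N ≈ 0# → ∀ a → natR p * a ≈ 0# → a ≈ 0#
  natR-*-cancel {p} {N} p⊥N N≈0 a pa≈0 = from-bézout (coprime-Bézout p⊥N)
    where
    open SetoidReasoning setoid
    N-multiple : ∀ z → natR (z ℕ.* N) * a ≈ 0#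
    N-multiple z = trans (*-congʳ (trans (natR-* z N) (trans (*-congˡ N≈0) (zeroʳ _)))) (zeroˡ a)
    p-multiple : ∀ z → natR (z ℕ.* p) * a ≈ 0#
    p-multiple z = trans (*-congʳ (natR-* z p)) (trans (*-assoc _ _ _) (trans (*-congˡ pa≈0) (zeroʳ _)))
    consecutive-annihilators : ∀ u v → suc u ≡ v → natR u * a ≈ 0# → natR v * a ≈ 0# → a ≈ 0#
    consecutive-annihilators u v 1+u≡v ua≈0 va≈0 = begin
      a                   ≈⟨ sym (+-identityʳ a) ⟩
      a + 0#              ≈⟨ +-congˡ (sym ua≈0) ⟩
      a + natR u * a      ≈⟨ natR-suc-* u a ⟨
      natR (suc u) * a    ≡⟨ ≡.cong (λ t → natR t * a) 1+u≡v ⟩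
      natR v * a          ≈⟨ va≈0 ⟩
      0#                  ∎
    from-bézout : Bézout.Identity 1 p N → a ≈ 0#
    from-bézout (Bézout.+- x y 1+yN≡xp) = consecutive-annihilators (y ℕ.* N) (x ℕ.* p) 1+yN≡xp (N-multiple y) (p-multiple x)
    from-bézout (Bézout.-+ x y 1+xp≡yN) = consecutive-annihilators (x ℕ.* p) (y ℕ.* N) 1+xp≡yN (p-multiple x) (N-multiple y)

  natR-p^t≈0⇒1≈0 : ∀ {p N} → Coprime p N → natR N ≈ 0# → ∀ t → natR (p ℕ.^ t) ≈ 0# → 1# ≈ 0#
  natR-p^t≈0⇒1≈0 p⊥N N≈0 zero    1+0≈0 = trans (sym (+-identityʳ 1#)) 1+0≈0
  natR-p^t≈0⇒1≈0 {p} p⊥N N≈0 (suc t) pᵗ⁺¹≈0 =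
    natR-p^t≈0⇒1≈0 p⊥N N≈0 t (natR-*-cancel p⊥N N≈0 _ (trans (sym (natR-* p (p ℕ.^ t))) pᵗ⁺¹≈0))

  p∤N⇒natR≉0 : ∀ {p N} → Prime p → ¬ 1# ≈ 0# → ∀ t → natR (p ℕ.^ t) ≈ 0# → ¬ p ∣ N → ¬ natR N ≈ 0#
  p∤N⇒natR≉0 p-prime 1≉0 t pᵗ≈0 p∤N N≈0 = 1≉0 (natR-p^t≈0⇒1≈0 (prime∤⇒coprime p-prime p∤N) N≈0 t pᵗ≈0)

module FiniteCommutativeRing {c ℓ : Level} (F : CommutativeRing c ℓ) {q : ℕ} (size : HasSize F q) where
  open CommutativeRing F hiding (zero)
  open Poly F using (natR)
  open RingProperties ring using (+-identityʳ-unique)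
  open SumProperties +-commutativeMonoid using (sum; sum-permute; sum-cong-≋; ∑-distrib-+; sum-replicate)
  open RawMonoidDefinitions (CommutativeMonoid.rawMonoid +-commutativeMonoid) using () renaming (_×_ to _times_)

  private
    e : Fin q → Carrier
    e = proj₁ size
    e-injective : ∀ i j → e i ≈ e j → i ≡ j
    e-injective = proj₁ (proj₂ size)
    index : Carrier → Fin q
    index x = proj₁ (proj₂ (proj₂ size) x)
    e-index : ∀ x → e (index x) ≈ x
    e-index x = proj₂ (proj₂ (proj₂ size) x)

  ≈-decidable : Decidable _≈_
  ≈-decidable x y with index x Finₚ.≟ index y
  ... | yes i≡j = yes (trans (sym (e-index x)) (trans (reflexive (≡.cong e i≡j)) (e-index y)))
  ... | no  i≢j = no λ x≈y → i≢j (e-injective _ _ (trans (e-index x) (trans x≈y (sym (e-index y)))))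

  shift : Carrier → Fin q → Fin q
  shift a i = index (e i + a)

  shift-cancel : ∀ a b → b + a ≈ 0# → ∀ i → shift a (shift b i) ≡ i
  shift-cancel a b b+a≈0 i = e-injective _ _ (begin
    e (shift a (shift b i)) ≈⟨ e-index _ ⟩
    e (shift b i) + a       ≈⟨ +-congʳ (e-index _) ⟩
    (e i + b) + a           ≈⟨ +-assoc _ _ _ ⟩
    e i + (b + a)           ≈⟨ +-congˡ b+a≈0 ⟩
    e i + 0#                ≈⟨ +-identityʳ _ ⟩
    e i                     ∎)
    where open SetoidReasoning setoid

  translation : Carrier → Permutation q q
  translation a = permutation (shift a) (shift (- a)) (shift-cancel a (- a) (-‿inverseˡ a)) (shift-cancel (- a) a (-‿inverseʳ a))

  natR≡times1# : ∀ n → natR n ≡ n times 1#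
  natR≡times1# zero    = ≡.refl
  natR≡times1# (suc n) = ≡.cong (1# +_) (natR≡times1# n)

  -- Translation by 1 permutes the elements: Σ x = Σ (x + 1) = Σ x + q · 1.
  natR-size≈0 : natR q ≈ 0#
  natR-size≈0 = trans (reflexive (natR≡times1# q)) (+-identityʳ-unique (sum e) (q times 1#) (begin
    sum e + q times 1#               ≈⟨ +-congˡ (sum-replicate q) ⟨
    sum e + sum {q} (λ _ → 1#)       ≈⟨ ∑-distrib-+ e (λ _ → 1#) ⟨
    sum (λ i → e i + 1#)             ≈⟨ sum-cong-≋ (λ i → e-index (e i + 1#)) ⟨
    sum (λ i → e (shift 1# i))       ≈⟨ sum-permute e (translation 1#) ⟨
    sum e                            ∎))
    where open SetoidReasoning setoid

module PolynomialCalculus {c ℓ : Level} (F : CommutativeRing c ℓ) where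
  open CommutativeRing F hiding (zero)
  open Poly F
  open PolynomialRing F
  open Characteristic F using (natR-+; natR-*)
  open RingProperties ring using (-0#≈0#)
  open CommutativeSemiringSolver commutativeSemiring using (solve; _:=_; _:+_; _:*_)
  open CommutativeSemiringSolver (CommutativeRing.commutativeSemiring polyRing) using ()
    renaming (solve to solveP; _:+_ to _⊕_; _:*_ to _⊗_; _:=_ to _⩦_; con to conP)

  mulP-constP : ∀ a g → mulP (constP a) g ≃ scaleP a g
  mulP-constP a g = ≃-trans (addP-cong ≃-refl (0∷-≃[] ≃-refl)) (addP-identityʳ _)

  scaleP-mulPʳ : ∀ a f g → mulP f (scaleP a g) ≃ scaleP a (mulP f g)
  scaleP-mulPʳ a f g =
    ≃-trans (mulP-comm f (scaleP a g)) (≃-trans (scaleP-mulPˡ a g f) (scaleP-cong refl (mulP-comm g f)))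

  coeff-shift : ∀ t f j → coeff (replicate t 0# ++ f) (t ℕ.+ j) ≡ coeff f j
  coeff-shift zero    f j = ≡.refl
  coeff-shift (suc t) f j = coeff-shift t f j

  coeff-shift-low : ∀ t f i → i < t → coeff (replicate t 0# ++ f) i ≈ 0#
  coeff-shift-low (suc t) f zero    _         = refl
  coeff-shift-low (suc t) f (suc i) (s≤s i<t) = coeff-shift-low t f i i<t

  mulP-xPow : ∀ t f → mulP (xPow t) f ≃ (replicate t 0# ++ f)
  mulP-xPow zero    f = mulP-identityˡ f
  mulP-xPow (suc t) f = addP-cong (scaleP-zero f) (∷-cong refl (mulP-xPow t f))

  coeff-derivAux : ∀ k f i → coeff (derivAux k f) i ≈ natR (i ℕ.+ k) * coeff f i
  coeff-derivAux k []      i       = sym (zeroʳ _)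
  coeff-derivAux k (b ∷ f) zero    = refl
  coeff-derivAux k (b ∷ f) (suc i) =
    trans (coeff-derivAux (suc k) f i) (*-congʳ (reflexive (≡.cong natR (ℕₚ.+-suc i k))))

  coeff-deriv : ∀ f i → coeff (deriv f) i ≈ natR (suc i) * coeff f (suc i)
  coeff-deriv []      i = sym (zeroʳ _)
  coeff-deriv (a ∷ f) i = trans (coeff-derivAux 1 f i) (*-congʳ (reflexive (≡.cong natR (ℕₚ.+-comm i 1))))

  deriv-cong : ∀ {f g} → f ≃ g → deriv f ≃ deriv g
  deriv-cong {f} {g} e = coeffwise λ i →
    trans (coeff-deriv f i) (trans (*-congˡ (at e (suc i))) (sym (coeff-deriv g i)))

  deriv-addP : ∀ f g → deriv (addP f g) ≃ addP (deriv f) (deriv g)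
  deriv-addP f g = coeffwise λ i →
    trans (coeff-deriv (addP f g) i) (trans (*-congˡ (coeff-addP f g (suc i))) (trans (distribˡ _ _ _)
      (sym (trans (coeff-addP (deriv f) (deriv g) i) (+-cong (coeff-deriv f i) (coeff-deriv g i))))))

  deriv-scaleP : ∀ a f → deriv (scaleP a f) ≃ scaleP a (deriv f)
  deriv-scaleP a f = coeffwise λ i →
    trans (coeff-deriv (scaleP a f) i) (trans (*-congˡ (coeff-scaleP a f (suc i)))
      (trans (solve 3 (λ n x y → n :* (x :* y) := x :* (n :* y)) refl (natR (suc i)) a (coeff f (suc i)))
             (sym (trans (coeff-scaleP a (deriv f) i) (*-congˡ (coeff-deriv f i))))))

  deriv-∷ : ∀ a f → deriv (a ∷ f) ≃ addP f (0# ∷ deriv f)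
  deriv-∷ a f = coeffwise λ i →
    trans (coeff-deriv (a ∷ f) i) (sym (trans (coeff-addP f (0# ∷ deriv f) i) (coeffs i)))
    where
    coeffs : ∀ i → coeff f i + coeff (0# ∷ deriv f) i ≈ natR (suc i) * coeff f i
    coeffs zero    = trans (+-identityʳ _) (sym (trans (*-congʳ (+-identityʳ 1#)) (*-identityˡ _)))
    coeffs (suc i) = trans (+-congˡ (coeff-deriv f i))
      (sym (trans (distribʳ (coeff f (suc i)) 1# (natR (suc i))) (+-congʳ (*-identityˡ _))))

  deriv-mulP : ∀ f g → deriv (mulP f g) ≃ addP (mulP (deriv f) g) (mulP f (deriv g))
  deriv-mulP []      g = ≃-refl
  deriv-mulP (a ∷ f) g = begin
    deriv (addP (scaleP a g) (0# ∷ mulP f g))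
      ≈⟨ deriv-addP (scaleP a g) (0# ∷ mulP f g) ⟩
    addP (deriv (scaleP a g)) (deriv (0# ∷ mulP f g))
      ≈⟨ addP-cong (deriv-scaleP a g) (≃-trans (deriv-∷ 0# (mulP f g))
           (addP-cong ≃-refl (∷-cong (sym (+-identityʳ 0#)) (deriv-mulP f g)))) ⟩
    addP A (addP B (addP C D))
      ≈⟨ solveP 4 (λ A B C D → A ⊕ (B ⊕ (C ⊕ D)) ⩦ (B ⊕ C) ⊕ (A ⊕ D)) ≃-refl A B C D ⟩
    addP (addP B C) (addP A D)
      ≈⟨ addP-cong (≃-sym (≃-trans (mulP-distribʳ f (0# ∷ deriv f) g)
           (addP-cong (≃-refl {B}) (addP-cong (scaleP-zero g) (≃-refl {C}))))) ≃-refl ⟩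
    addP (mulP (addP f (0# ∷ deriv f)) g) (mulP (a ∷ f) (deriv g))
      ≈⟨ addP-cong (mulP-congˡ g (≃-sym (deriv-∷ a f))) ≃-refl ⟩
    addP (mulP (deriv (a ∷ f)) g) (mulP (a ∷ f) (deriv g)) ∎
    where
    open SetoidReasoning ≃-setoid
    A = scaleP a (deriv g)
    B = mulP f g
    C = 0# ∷ mulP (deriv f) g
    D = 0# ∷ mulP f (deriv g)

  deriv-powP : ∀ f k → deriv (powP f (suc k)) ≃ scaleP (natR (suc k)) (mulP (deriv f) (powP f k))
  deriv-powP f zero = begin
    deriv (mulP f oneP)                               ≈⟨ deriv-mulP f oneP ⟩
    addP (mulP (deriv f) oneP) (mulP f [])            ≈⟨ ≃-trans (addP-cong ≃-refl (mulP-zeroʳ f)) (addP-identityʳ _) ⟩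
    mulP (deriv f) oneP                               ≈⟨ ≃-sym (≃-trans (scaleP-cong (+-identityʳ 1#) ≃-refl) (scaleP-identity _)) ⟩
    scaleP (natR 1) (mulP (deriv f) oneP)             ∎
    where open SetoidReasoning ≃-setoid
  deriv-powP f (suc k) = begin
    deriv (mulP f fᵏ⁺¹)
      ≈⟨ deriv-mulP f fᵏ⁺¹ ⟩
    addP Y (mulP f (deriv fᵏ⁺¹))
      ≈⟨ addP-cong ≃-refl (≃-trans (mulP-congʳ f (deriv-powP f k)) (scaleP-mulPʳ n f (mulP f' fᵏ))) ⟩
    addP Y (scaleP n (mulP f (mulP f' fᵏ)))
      ≈⟨ addP-cong ≃-refl (scaleP-cong refl (solveP 3 (λ f f' fᵏ → f ⊗ (f' ⊗ fᵏ) ⩦ f' ⊗ (f ⊗ fᵏ)) ≃-refl f f' fᵏ)) ⟩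
    addP Y (scaleP n Y)
      ≈⟨ ≃-sym (≃-trans (scaleP-distribʳ 1# n Y) (addP-cong (scaleP-identity Y) ≃-refl)) ⟩
    scaleP (1# + n) Y ∎
    where
    open SetoidReasoning ≃-setoid
    n = natR (suc k)
    f' = deriv f
    fᵏ = powP f k
    fᵏ⁺¹ = powP f (suc k)
    Y = mulP f' fᵏ⁺¹

  DegreeBelow : Pol → ℕ → Set ℓ
  DegreeBelow f M = ∀ i → M ≤ i → coeff f i ≈ 0#

  -- Chosen so that HasDegree f d unfolds to (coeff f d ≉ 0#) × DegreeAtMost f d.
  DegreeAtMost : Pol → ℕ → Set ℓ
  DegreeAtMost f d = DegreeBelow f (suc d)

  length-DegreeBelow : ∀ f → DegreeBelow f (length f)
  length-DegreeBelow []      i       _         = refl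
  length-DegreeBelow (a ∷ f) (suc i) (s≤s l≤i) = length-DegreeBelow f i l≤i

  DegreeBelow-≃ : ∀ {f g M} → f ≃ g → DegreeBelow f M → DegreeBelow g M
  DegreeBelow-≃ e d i M≤i = trans (sym (at e i)) (d i M≤i)

  DegreeBelow-mono : ∀ {f M N} → M ≤ N → DegreeBelow f M → DegreeBelow f N
  DegreeBelow-mono M≤N d i N≤i = d i (ℕₚ.≤-trans M≤N N≤i)

  DegreeBelow-addP : ∀ {f g M} → DegreeBelow f M → DegreeBelow g M → DegreeBelow (addP f g) M
  DegreeBelow-addP {f} {g} df dg i M≤i =
    trans (coeff-addP f g i) (trans (+-cong (df i M≤i) (dg i M≤i)) (+-identityʳ 0#))

  DegreeBelow-scaleP : ∀ {f M} a → DegreeBelow f M → DegreeBelow (scaleP a f) M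
  DegreeBelow-scaleP {f} a df i M≤i = trans (coeff-scaleP a f i) (trans (*-congˡ (df i M≤i)) (zeroʳ a))

  DegreeAtMost-deriv : ∀ {f d} → DegreeAtMost f (suc d) → DegreeAtMost (deriv f) d
  DegreeAtMost-deriv {f} df i d<i = trans (coeff-deriv f i) (trans (*-congˡ (df (suc i) (s≤s d<i))) (zeroʳ _))

  ∷-DegreeAtMost-0 : ∀ {a f} → DegreeAtMost (a ∷ f) 0 → f ≃ []
  ∷-DegreeAtMost-0 d = coeffwise λ i → d (suc i) (s≤s z≤n)

  DegreeAtMost-mulP : ∀ f g a b → DegreeAtMost f a → DegreeAtMost g b → DegreeAtMost (mulP f g) (a ℕ.+ b)
  DegreeAtMost-mulP []      g a       b df dg i       _ = refl
  DegreeAtMost-mulP (x ∷ f) g zero    b df dg i       b<i =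
    trans (coeff-mulP-∷ x f g i)
      (trans (+-cong (trans (*-congˡ (dg i b<i)) (zeroʳ x)) (at (0∷-≃[] (mulP-≃[]ˡ f g (∷-DegreeAtMost-0 df))) i))
             (+-identityʳ 0#))
  DegreeAtMost-mulP (x ∷ f) g (suc a) b df dg (suc i) (s≤s a+b<i) =
    trans (coeff-mulP-∷ x f g (suc i))
      (trans (+-cong (trans (*-congˡ (dg (suc i) (s≤s (ℕₚ.≤-trans (ℕₚ.m≤n+m b a) (ℕₚ.<⇒≤ a+b<i))))) (zeroʳ x))
                     (DegreeAtMost-mulP f g a b (λ j a<j → df (suc j) (s≤s a<j)) dg i a+b<i))
             (+-identityʳ 0#))

  coeff-mulP-top : ∀ f g a b → DegreeAtMost f a → DegreeAtMost g b →
                   coeff (mulP f g) (a ℕ.+ b) ≈ coeff f a * coeff g b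
  coeff-mulP-top []      g a       b df dg = sym (zeroˡ _)
  coeff-mulP-top (x ∷ f) g zero    b df dg =
    trans (coeff-mulP-∷ x f g b) (trans (+-congˡ (at (0∷-≃[] (mulP-≃[]ˡ f g (∷-DegreeAtMost-0 df))) b)) (+-identityʳ _))
  coeff-mulP-top (x ∷ f) g (suc a) b df dg =
    trans (coeff-mulP-∷ x f g (suc (a ℕ.+ b)))
      (trans (+-cong (trans (*-congˡ (dg (suc (a ℕ.+ b)) (s≤s (ℕₚ.m≤n+m b a)))) (zeroʳ x))
                     (coeff-mulP-top f g a b (λ j a<j → df (suc j) (s≤s a<j)) dg))
             (+-identityˡ _))

  VanishesBelow : Pol → ℕ → Set ℓ
  VanishesBelow f N = ∀ i → i < N → coeff f i ≈ 0#

  VanishesBelow-≃ : ∀ {f g N} → f ≃ g → VanishesBelow f N → VanishesBelow g N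
  VanishesBelow-≃ e v i i<N = trans (sym (at e i)) (v i i<N)

  VanishesBelow∧DegreeBelow⇒≃[] : ∀ {f N} → VanishesBelow f N → DegreeBelow f N → f ≃ []
  VanishesBelow∧DegreeBelow⇒≃[] {f} {N} v d = coeffwise λ i → [ v i , d i ]′ (ℕₚ.<-≤-connex i N)
    where open Data.Sum using ([_,_]′)

  coeff-mulP-0 : ∀ f g → coeff (mulP f g) 0 ≈ coeff f 0 * coeff g 0
  coeff-mulP-0 []      g = sym (zeroˡ _)
  coeff-mulP-0 (x ∷ f) g = trans (coeff-mulP-∷ x f g 0) (+-identityʳ _)

  coeff-powP-0 : ∀ f k → coeff f 0 ≈ 1# → coeff (powP f k) 0 ≈ 1#
  coeff-powP-0 f zero    f₀≈1 = refl
  coeff-powP-0 f (suc k) f₀≈1 =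
    trans (coeff-mulP-0 f (powP f k)) (trans (*-cong f₀≈1 (coeff-powP-0 f k f₀≈1)) (*-identityˡ 1#))

  -- A factor with constant term 1 is invertible in F[[x]], so it does not change the x-adic order.
  VanishesBelow-cancelʳ : ∀ {T} → coeff T 0 ≈ 1# → ∀ N G → VanishesBelow (mulP G T) N → VanishesBelow G N
  VanishesBelow-cancelʳ T₀≈1 (suc N) []      v i       _         = refl
  VanishesBelow-cancelʳ {T} T₀≈1 (suc N) (g ∷ G) v i i<N = vanish i i<N
    where
    g≈0 : g ≈ 0#
    g≈0 = trans (sym (trans (coeff-mulP-0 (g ∷ G) T) (trans (*-congˡ T₀≈1) (*-identityʳ g)))) (v 0 (s≤s z≤n))
    vG : VanishesBelow (mulP G T) N
    vG j j<N = trans (sym (trans (coeff-mulP-∷ g G T (suc j))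
                                 (trans (+-congʳ (trans (*-congʳ g≈0) (zeroˡ _))) (+-identityˡ _))))
                     (v (suc j) (s≤s j<N))
    vanish : VanishesBelow (g ∷ G) (suc N)
    vanish zero    _         = g≈0
    vanish (suc i) (s≤s i<N) = VanishesBelow-cancelʳ T₀≈1 N G vG i i<N

  mulP-cancelˡ-≃[] : ∀ T G → coeff T 0 ≈ 1# → mulP T G ≃ [] → G ≃ []
  mulP-cancelˡ-≃[] T G T₀≈1 e = coeffwise λ i →
    VanishesBelow-cancelʳ T₀≈1 (suc i) G (λ j _ → at (≃-trans (mulP-comm G T) e) j) i (ℕₚ.n<1+n i)

  reducedDeriv : ℕ → Pol → Pol → Pol
  reducedDeriv m R S = addP (scaleP (natR m) (mulP (deriv R) S)) (mulP R (deriv S))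

  deriv-powP-mulP : ∀ R S m → deriv (mulP (powP R (suc m)) S) ≃ mulP (powP R m) (reducedDeriv (suc m) R S)
  deriv-powP-mulP R S m = begin
    deriv (mulP (powP R (suc m)) S)
      ≈⟨ deriv-mulP (powP R (suc m)) S ⟩
    addP (mulP (deriv (powP R (suc m))) S) (mulP (mulP R Rᵐ) S')
      ≈⟨ addP-cong (mulP-congˡ S (≃-trans (deriv-powP R m) (≃-sym (mulP-constP M (mulP R' Rᵐ))))) ≃-refl ⟩
    addP (mulP (mulP K (mulP R' Rᵐ)) S) (mulP (mulP R Rᵐ) S')
      ≈⟨ solveP 6 (λ K R' Rᵐ S R S' → ((K ⊗ (R' ⊗ Rᵐ)) ⊗ S) ⊕ ((R ⊗ Rᵐ) ⊗ S') ⩦ Rᵐ ⊗ ((K ⊗ (R' ⊗ S)) ⊕ (R ⊗ S')))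
                  ≃-refl K R' Rᵐ S R S' ⟩
    mulP Rᵐ (addP (mulP K (mulP R' S)) (mulP R S'))
      ≈⟨ mulP-congʳ Rᵐ (addP-cong (mulP-constP M (mulP R' S)) ≃-refl) ⟩
    mulP Rᵐ (reducedDeriv (suc m) R S) ∎
    where
    open SetoidReasoning ≃-setoid
    M = natR (suc m)
    K = constP M
    R' = deriv R
    S' = deriv S
    Rᵐ = powP R m

  reducedDeriv-cong : ∀ n R {U V} → U ≃ V → reducedDeriv n R U ≃ reducedDeriv n R V
  reducedDeriv-cong n R e = addP-cong (scaleP-cong refl (mulP-congʳ (deriv R) e)) (mulP-congʳ R (deriv-cong e))

  reducedDeriv-mulP : ∀ n R U → reducedDeriv n R (mulP R U) ≃ mulP R (reducedDeriv (suc n) R U)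
  reducedDeriv-mulP n R U = begin
    reducedDeriv n R (mulP R U)
      ≈⟨ addP-cong (≃-sym (mulP-constP (natR n) (mulP R' (mulP R U)))) (mulP-congʳ R (deriv-mulP R U)) ⟩
    addP (mulP K (mulP R' (mulP R U))) (mulP R (addP (mulP R' U) (mulP R (deriv U))))
      ≈⟨ solveP 5 (λ K R' R U U' → (K ⊗ (R' ⊗ (R ⊗ U))) ⊕ (R ⊗ ((R' ⊗ U) ⊕ (R ⊗ U')))
                                    ⩦ R ⊗ (((conP 1 ⊕ K) ⊗ (R' ⊗ U)) ⊕ (R ⊗ U'))) ≃-refl K R' R U (deriv U) ⟩
    mulP R (addP (mulP (addP (oneP ++ []) K) (mulP R' U)) (mulP R (deriv U)))
      ≈⟨ mulP-congʳ R (addP-cong (mulP-constP (1# + natR n) (mulP R' U)) ≃-refl) ⟩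
    mulP R (reducedDeriv (suc n) R U) ∎
    where
    open SetoidReasoning ≃-setoid
    R' = deriv R
    K = constP (natR n)

  DegreeAtMost-reducedDeriv : ∀ m R S D E → DegreeAtMost R (suc D) → DegreeAtMost S (suc E) →
                              DegreeAtMost (reducedDeriv m R S) (D ℕ.+ suc E)
  DegreeAtMost-reducedDeriv m R S D E dR dS =
    DegreeBelow-addP {scaleP (natR m) (mulP (deriv R) S)} {mulP R (deriv S)}
      (DegreeBelow-scaleP {mulP (deriv R) S} (natR m) (DegreeAtMost-mulP (deriv R) S D (suc E) (DegreeAtMost-deriv {R} dR) dS))
      (DegreeBelow-mono {mulP R (deriv S)} (s≤s (ℕₚ.≤-reflexive (≡.sym (ℕₚ.+-suc D E))))
        (DegreeAtMost-mulP R (deriv S) (suc D) E dR (DegreeAtMost-deriv {S} dS)))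

  -- deg R' + deg S = deg R + deg S' = D + suc E.
  coeff-reducedDeriv-top : ∀ m R S D E → DegreeAtMost R (suc D) → DegreeAtMost S (suc E) →
    coeff (reducedDeriv m R S) (D ℕ.+ suc E) ≈
    natR (m ℕ.* suc D ℕ.+ suc E) * (coeff R (suc D) * coeff S (suc E))
  coeff-reducedDeriv-top m R S D E dR dS = begin
    coeff (reducedDeriv m R S) (D ℕ.+ suc E)
      ≈⟨ coeff-addP (scaleP M (mulP R' S)) (mulP R S') (D ℕ.+ suc E) ⟩
    coeff (scaleP M (mulP R' S)) (D ℕ.+ suc E) + coeff (mulP R S') (D ℕ.+ suc E)
      ≈⟨ +-cong (trans (coeff-scaleP M (mulP R' S) _) (*-congˡ (trans
                  (coeff-mulP-top R' S D (suc E) (DegreeAtMost-deriv {R} dR) dS) (*-congʳ (coeff-deriv R D)))))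
                (trans (reflexive (≡.cong (coeff (mulP R S')) (ℕₚ.+-suc D E)))
                  (trans (coeff-mulP-top R S' (suc D) E dR (DegreeAtMost-deriv {S} dS)) (*-congˡ (coeff-deriv S E)))) ⟩
    M * ((d * r) * s) + r * (e * s)
      ≈⟨ solve 5 (λ M d e r s → M :* ((d :* r) :* s) :+ r :* (e :* s) := (M :* d :+ e) :* (r :* s)) refl M d e r s ⟩
    (M * d + e) * (r * s)
      ≈⟨ *-congʳ (sym (trans (natR-+ (m ℕ.* suc D) (suc E)) (+-congʳ (natR-* m (suc D))))) ⟩
    natR (m ℕ.* suc D ℕ.+ suc E) * (r * s) ∎
    where
    open SetoidReasoning setoid
    M = natR m
    R' = deriv R
    S' = deriv S
    r = coeff R (suc D)
    s = coeff S (suc E)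
    d = natR (suc D)
    e = natR (suc E)

  -- The derivative of R^(m+1) S - 1 vanishes below x^N, and the cofactor R^m has constant term 1.
  reducedDeriv-VanishesBelow : ∀ R S m N → coeff R 0 ≈ 1# →
    DividesP (xPow (suc N)) (subP (mulP (powP R (suc m)) S) oneP) →
    VanishesBelow (reducedDeriv (suc m) R S) N
  reducedDeriv-VanishesBelow R S m N R₀≈1 (Q , P-1≈xᴺ⁺¹Q) =
    VanishesBelow-cancelʳ (coeff-powP-0 R m R₀≈1) N (reducedDeriv (suc m) R S)
      (VanishesBelow-≃ (≃-trans (deriv-powP-mulP R S m) (mulP-comm (powP R m) _)) P'-vanishes)
    where
    P = mulP (powP R (suc m)) S
    P-vanishes : ∀ j → suc j < suc N → coeff P (suc j) ≈ 0#
    P-vanishes j j<N = begin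
      coeff P (suc j)                              ≈⟨ sym (trans (+-congˡ -0#≈0#) (+-identityʳ _)) ⟩
      coeff P (suc j) + - coeff oneP (suc j)       ≈⟨ sym (trans (coeff-addP P (negP oneP) (suc j)) (+-congˡ (coeff-negP oneP (suc j)))) ⟩
      coeff (subP P oneP) (suc j)                  ≈⟨ P-1≈xᴺ⁺¹Q (suc j) ⟩
      coeff (mulP (xPow (suc N)) Q) (suc j)        ≈⟨ at (mulP-xPow (suc N) Q) (suc j) ⟩
      coeff (replicate (suc N) 0# ++ Q) (suc j)    ≈⟨ coeff-shift-low (suc N) Q (suc j) j<N ⟩
      0# ∎
      where open SetoidReasoning setoid
    P'-vanishes : VanishesBelow (deriv P) N
    P'-vanishes j j<N = trans (coeff-deriv P j) (trans (*-congˡ (P-vanishes j (s≤s j<N))) (zeroʳ _))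

  contact⇒reducedDeriv≃[] : ∀ R S m D E → coeff R 0 ≈ 1# → DegreeAtMost R (suc D) → DegreeAtMost S (suc E) →
    DividesP (xPow (suc D ℕ.+ suc E ℕ.+ 1)) (subP (mulP (powP R (suc m)) S) oneP) →
    reducedDeriv (suc m) R S ≃ []
  contact⇒reducedDeriv≃[] R S m D E R₀≈1 dR dS xᴺ⁺¹∣P-1 =
    VanishesBelow∧DegreeBelow⇒≃[]
      (reducedDeriv-VanishesBelow R S m (suc D ℕ.+ suc E) R₀≈1
        (≡.subst (λ t → DividesP (xPow t) (subP (mulP (powP R (suc m)) S) oneP)) (ℕₚ.+-comm (suc D ℕ.+ suc E) 1) xᴺ⁺¹∣P-1))
      (DegreeAtMost-reducedDeriv (suc m) R S D E dR dS)

module PolynomialsOverField {c ℓ : Level} (F : CommutativeRing c ℓ) (isField : IsField F)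
  (_≟_ : Decidable (CommutativeRing._≈_ F)) where
  open CommutativeRing F hiding (zero)
  open IsField isField
  open Poly F
  open PolynomialRing F
  open PolynomialCalculus F
  open RingProperties ring using (-0#≈0#)
  open RingProperties (CommutativeRing.ring polyRing) using ()
    renaming (-‿distribʳ-* to negP-distribʳ-mulP; +-inverseˡ-unique to addP-inverseˡ-unique;
              x[y-z]≈xy-xz to mulP-distribˡ-subP)
  open CommutativeRing polyRing using () renaming (*-identityʳ to mulP-identityʳ)
  open CommutativeSemiringSolver (CommutativeRing.commutativeSemiring polyRing) using ()
    renaming (solve to solveP; _:+_ to _⊕_; _:*_ to _⊗_; _:=_ to _⩦_)

  x*y≈0⇒x≈0 : ∀ {x y} → ¬ y ≈ 0# → x * y ≈ 0# → x ≈ 0#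
  x*y≈0⇒x≈0 {x} {y} y≉0 xy≈0 = begin
    x           ≈⟨ sym (*-identityʳ x) ⟩
    x * 1#      ≈⟨ *-congˡ (sym (proj₂ (inverse y y≉0))) ⟩
    x * (y * z) ≈⟨ sym (*-assoc x y z) ⟩
    (x * y) * z ≈⟨ *-congʳ xy≈0 ⟩
    0# * z      ≈⟨ zeroˡ z ⟩
    0#          ∎
    where
    open SetoidReasoning setoid
    z = proj₁ (inverse y y≉0)

  x≉0∧y≉0⇒x*y≉0 : ∀ {x y} → ¬ x ≈ 0# → ¬ y ≈ 0# → ¬ x * y ≈ 0#
  x≉0∧y≉0⇒x*y≉0 x≉0 y≉0 xy≈0 = x≉0 (x*y≈0⇒x≈0 y≉0 xy≈0)

  HasDegree-≃ : ∀ {f g d} → f ≃ g → HasDegree f d → HasDegree g d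
  HasDegree-≃ {d = d} e (lead≉0 , deg≤d) = (λ lead≈0 → lead≉0 (trans (at e d) lead≈0)) , DegreeBelow-≃ e deg≤d

  HasDegree-mulP : ∀ f g a b → HasDegree f a → HasDegree g b → HasDegree (mulP f g) (a ℕ.+ b)
  HasDegree-mulP f g a b (fₐ≉0 , df) (g_b≉0 , dg) =
    (λ top≈0 → x≉0∧y≉0⇒x*y≉0 fₐ≉0 g_b≉0 (trans (sym (coeff-mulP-top f g a b df dg)) top≈0)) ,
    DegreeAtMost-mulP f g a b df dg

  HasDegree-unique : ∀ {f a b} → HasDegree f a → HasDegree f b → a ≡ b
  HasDegree-unique {f} {a} {b} (fₐ≉0 , da) (f_b≉0 , db) with ℕₚ.<-cmp a b
  ... | tri< a<b _ _ = ⊥-elim (f_b≉0 (da b a<b))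
  ... | tri≈ _ a≡b _ = a≡b
  ... | tri> _ _ b<a = ⊥-elim (fₐ≉0 (db a b<a))

  ≃[]⊎HasDegree : ∀ f → f ≃ [] ⊎ ∃ (HasDegree f)
  ≃[]⊎HasDegree []      = inj₁ ≃-refl
  ≃[]⊎HasDegree (a ∷ f) with ≃[]⊎HasDegree f
  ... | inj₂ (d , lead≉0 , deg≤d) = inj₂ (suc d , lead≉0 , λ { (suc i) (s≤s d<i) → deg≤d i d<i })
  ... | inj₁ f≃[] with a ≟ 0#
  ...   | yes a≈0 = inj₁ (coeffwise λ { zero → a≈0 ; (suc i) → at f≃[] i })
  ...   | no  a≉0 = inj₂ (0 , a≉0 , λ { (suc i) _ → at f≃[] i })

  addP-negP-cancelʳ : ∀ A X → addP (addP A (negP X)) X ≃ A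
  addP-negP-cancelʳ A X =
    ≃-trans (addP-assoc A (negP X) X)
      (≃-trans (addP-cong ≃-refl (≃-trans (addP-comm (negP X) X) (addP-inverseʳ X))) (addP-identityʳ A))

  -- Subtracting (a/b) x^(M-e) B, with a the coefficient of x^M in A and b the leading one of B.
  divisionStep : ∀ M A B e → e ≤ M → HasDegree B e → ∀ b⁻¹ → b⁻¹ * coeff B e ≈ 1# → DegreeBelow A (suc M) →
                 Σ Pol λ A₁ → Σ Pol λ T → DegreeBelow A₁ M × (A ≃ addP A₁ (mulP T B))
  divisionStep M A B e e≤M (_ , deg-B) b⁻¹ b⁻¹b≈1 deg-A = A₁ , T , deg-A₁ , ≃-sym (addP-negP-cancelʳ A TB)
    where
    open SetoidReasoning setoid
    t = M ∸ e
    a = coeff A M * b⁻¹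
    T = scaleP a (xPow t)
    TB = mulP T B
    A₁ = addP A (negP TB)
    xᵗB = replicate t 0# ++ B
    t+e≡M : t ℕ.+ e ≡ M
    t+e≡M = ≡.trans (ℕₚ.+-comm t e) (ℕₚ.m+[n∸m]≡n e≤M)
    coeff-A₁ : ∀ i → coeff A₁ i ≈ coeff A i + - (a * coeff xᵗB i)
    coeff-A₁ i = trans (coeff-addP A (negP TB) i) (+-congˡ (trans (coeff-negP TB i) (-‿cong
      (trans (at (scaleP-mulPˡ a (xPow t) B) i) (trans (coeff-scaleP a (mulP (xPow t) B) i)
        (*-congˡ (at (mulP-xPow t B) i)))))))
    coeff-xᵗB-M : coeff xᵗB M ≈ coeff B e
    coeff-xᵗB-M = reflexive (≡.trans (≡.cong (coeff xᵗB) (≡.sym t+e≡M)) (coeff-shift t B e))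
    coeff-xᵗB-high : ∀ i → M < i → coeff xᵗB i ≈ 0#
    coeff-xᵗB-high i M<i = begin
      coeff xᵗB i              ≡⟨ ≡.cong (coeff xᵗB) (≡.sym t+[i∸t]≡i) ⟩
      coeff xᵗB (t ℕ.+ (i ∸ t)) ≡⟨ coeff-shift t B (i ∸ t) ⟩
      coeff B (i ∸ t)          ≈⟨ deg-B (i ∸ t) (ℕₚ.+-cancelˡ-< t e (i ∸ t) (≡.subst₂ _<_ (≡.sym t+e≡M) (≡.sym t+[i∸t]≡i) M<i)) ⟩
      0#                       ∎
      where
      t+[i∸t]≡i : t ℕ.+ (i ∸ t) ≡ i
      t+[i∸t]≡i = ℕₚ.m+[n∸m]≡n (ℕₚ.≤-trans (ℕₚ.m≤m+n t e) (ℕₚ.≤-trans (ℕₚ.≤-reflexive t+e≡M) (ℕₚ.<⇒≤ M<i)))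
    deg-A₁ : DegreeBelow A₁ M
    deg-A₁ i M≤i with ℕₚ.m≤n⇒m<n∨m≡n M≤i
    ... | inj₂ ≡.refl = begin
      coeff A₁ M                                 ≈⟨ coeff-A₁ M ⟩
      coeff A M + - ((coeff A M * b⁻¹) * coeff xᵗB M) ≈⟨ +-congˡ (-‿cong (*-congˡ coeff-xᵗB-M)) ⟩
      coeff A M + - ((coeff A M * b⁻¹) * coeff B e)   ≈⟨ +-congˡ (-‿cong (trans (*-assoc _ _ _) (trans (*-congˡ b⁻¹b≈1) (*-identityʳ _)))) ⟩
      coeff A M + - coeff A M                    ≈⟨ -‿inverseʳ _ ⟩
      0#                                         ∎
    ... | inj₁ M<i = begin
      coeff A₁ i                      ≈⟨ coeff-A₁ i ⟩
      coeff A i + - (a * coeff xᵗB i) ≈⟨ +-cong (deg-A i M<i) (-‿cong (trans (*-congˡ (coeff-xᵗB-high i M<i)) (zeroʳ a))) ⟩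
      0# + - 0#                       ≈⟨ trans (+-identityˡ _) -0#≈0# ⟩
      0#                              ∎

  division : ∀ M A B e → DegreeBelow A M → HasDegree B e →
             Σ Pol λ Q → Σ Pol λ Rm → (A ≃ addP (mulP Q B) Rm) × DegreeBelow Rm e
  division M A B e deg-A deg-B with M ℕ.≤? e
  ... | yes M≤e = [] , A , ≃-refl , DegreeBelow-mono {A} M≤e deg-A
  division zero    A B e deg-A deg-B | no M≰e = ⊥-elim (M≰e z≤n)
  division (suc M) A B e deg-A deg-B | no M≰e with inverse (coeff B e) (proj₁ deg-B)
  ... | b⁻¹ , bb⁻¹≈1 with divisionStep M A B e (ℕₚ.≤-pred (ℕₚ.≰⇒> M≰e)) deg-B b⁻¹ (trans (*-comm b⁻¹ _) bb⁻¹≈1) deg-A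
  ... | A₁ , T , deg-A₁ , A≃A₁+TB with division M A₁ B e deg-A₁ deg-B
  ... | Q₁ , Rm , A₁≃Q₁B+Rm , deg-Rm = addP Q₁ T , Rm ,
    ≃-trans A≃A₁+TB (≃-trans (addP-cong A₁≃Q₁B+Rm ≃-refl)
      (solveP 4 (λ Q B R T → ((Q ⊗ B) ⊕ R) ⊕ (T ⊗ B) ⩦ ((Q ⊕ T) ⊗ B) ⊕ R) ≃-refl Q₁ B Rm T)) ,
    deg-Rm

  division-coprime : ∀ {A B Q Rm} → A ≃ addP (mulP Q B) Rm → CoprimeP A B → CoprimeP B Rm
  division-coprime {A} {B} {Q} {Rm} A≃QB+R A⊥B d (u , B≈du) (v , R≈dv) =
    A⊥B d (addP (mulP Q u) v , at A≃d[Qu+v]) (u , B≈du)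
    where
    A≃d[Qu+v] : A ≃ mulP d (addP (mulP Q u) v)
    A≃d[Qu+v] = ≃-trans A≃QB+R (≃-trans (addP-cong (mulP-congʳ Q (coeffwise B≈du)) (coeffwise R≈dv))
      (solveP 4 (λ Q d u v → (Q ⊗ (d ⊗ u)) ⊕ (d ⊗ v) ⩦ d ⊗ ((Q ⊗ u) ⊕ v)) ≃-refl Q d u v))

  division-bezout : ∀ {A B Q Rm X Y} → A ≃ addP (mulP Q B) Rm → addP (mulP B X) (mulP Rm Y) ≃ oneP →
                    addP (mulP A Y) (mulP B (subP X (mulP Q Y))) ≃ oneP
  division-bezout {A} {B} {Q} {Rm} {X} {Y} A≃QB+R BX+RY≃1 = begin
    addP (mulP A Y) (mulP B (subP X (mulP Q Y)))
      ≈⟨ addP-cong (mulP-congˡ Y A≃QB+R) (mulP-distribˡ-subP B X (mulP Q Y)) ⟩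
    addP (mulP (addP (mulP Q B) Rm) Y) (addP (mulP B X) (negP (mulP B (mulP Q Y))))
      ≈⟨ solveP 6 (λ Q B R X Y N → (((Q ⊗ B) ⊕ R) ⊗ Y) ⊕ ((B ⊗ X) ⊕ N)
                                 ⩦ ((B ⊗ X) ⊕ (R ⊗ Y)) ⊕ ((B ⊗ (Q ⊗ Y)) ⊕ N))
                 ≃-refl Q B Rm X Y (negP (mulP B (mulP Q Y))) ⟩
    addP (addP (mulP B X) (mulP Rm Y)) (addP (mulP B (mulP Q Y)) (negP (mulP B (mulP Q Y))))
      ≈⟨ addP-cong BX+RY≃1 (addP-inverseʳ (mulP B (mulP Q Y))) ⟩
    addP oneP []
      ≈⟨ addP-identityʳ oneP ⟩
    oneP ∎
    where open SetoidReasoning ≃-setoid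

  -- Euclid's algorithm; the first argument bounds the degree of B and decreases.
  bezout : ∀ N A B → DegreeBelow B N → CoprimeP A B →
           Σ Pol λ X → Σ Pol λ Y → addP (mulP A X) (mulP B Y) ≃ oneP
  bezout zero A B deg-B A⊥B = X , [] , ≃-trans (addP-cong AX≃1 (mulP-zeroʳ B)) (addP-identityʳ oneP)
    where
    B≃[] : B ≃ []
    B≃[] = coeffwise λ i → deg-B i z≤n
    A-unit : IsUnitP A
    A-unit = A⊥B A (oneP , at (≃-sym (mulP-identityʳ A))) ([] , at (≃-trans B≃[] (≃-sym (mulP-zeroʳ A))))
    X = proj₁ A-unit
    AX≃1 : mulP A X ≃ oneP
    AX≃1 = coeffwise (proj₂ A-unit)
  bezout (suc N) A B deg-B A⊥B with coeff B N ≟ 0#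
  ... | yes b≈0 = bezout N A B deg-B' A⊥B
    where
    deg-B' : DegreeBelow B N
    deg-B' i N≤i with ℕₚ.m≤n⇒m<n∨m≡n N≤i
    ... | inj₁ N<i    = deg-B i N<i
    ... | inj₂ ≡.refl = b≈0
  ... | no b≉0 with division (length A) A B N (length-DegreeBelow A) (b≉0 , deg-B)
  ... | Q , Rm , A≃QB+R , deg-R with bezout N B Rm deg-R (division-coprime {A} {B} {Q} {Rm} A≃QB+R A⊥B)
  ... | X , Y , BX+RY≃1 = Y , subP X (mulP Q Y) , division-bezout {A} {B} {Q} {Rm} {X} {Y} A≃QB+R BX+RY≃1

  coprime-∣ : ∀ A B U W → CoprimeP A B → mulP B U ≃ mulP A W → Σ Pol λ U₂ → U ≃ mulP A U₂
  coprime-∣ A B U W A⊥B BU≃AW with bezout (length B) A B (length-DegreeBelow B) A⊥B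
  ... | X , Y , AX+BY≃1 = addP (mulP U X) (mulP W Y) , (begin
    U                                            ≈⟨ ≃-sym (mulP-identityʳ U) ⟩
    mulP U oneP                                  ≈⟨ mulP-congʳ U (≃-sym AX+BY≃1) ⟩
    mulP U (addP (mulP A X) (mulP B Y))          ≈⟨ solveP 5 (λ U A X B Y → U ⊗ ((A ⊗ X) ⊕ (B ⊗ Y)) ⩦ (A ⊗ (U ⊗ X)) ⊕ ((B ⊗ U) ⊗ Y)) ≃-refl U A X B Y ⟩
    addP (mulP A (mulP U X)) (mulP (mulP B U) Y) ≈⟨ addP-cong ≃-refl (mulP-congˡ Y BU≃AW) ⟩
    addP (mulP A (mulP U X)) (mulP (mulP A W) Y) ≈⟨ solveP 5 (λ U A X W Y → (A ⊗ (U ⊗ X)) ⊕ ((A ⊗ W) ⊗ Y) ⩦ A ⊗ ((U ⊗ X) ⊕ (W ⊗ Y))) ≃-refl U A X W Y ⟩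
    mulP A (addP (mulP U X) (mulP W Y))          ∎)
    where open SetoidReasoning ≃-setoid

  module _ (R : Pol) {D : ℕ} (deg-R : HasDegree R (suc D)) (R₀≈1 : coeff R 0 ≈ 1#) (R⊥R' : CoprimeP R (deriv R)) where

    -- n R' U = - R U' and gcd(R, R') = 1 give R ∣ U; then use reducedDeriv-mulP and cancel R.
    reducedDeriv≃[]-descent : ∀ n U → ¬ natR n ≈ 0# → reducedDeriv n R U ≃ [] →
                              Σ Pol λ U₂ → U ≃ mulP R U₂ × reducedDeriv (suc n) R U₂ ≃ []
    reducedDeriv≃[]-descent n U n≉0 G≃[] = U₂ , U≃RU₂ , mulP-cancelˡ-≃[] R (reducedDeriv (suc n) R U₂) R₀≈1 RG₂≃[]
      where
      open SetoidReasoning ≃-setoid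
      R' = deriv R
      U' = deriv U
      ν = natR n
      ν⁻¹ = proj₁ (inverse ν n≉0)
      R'U≃R[-ν⁻¹U'] : mulP R' U ≃ mulP R (scaleP ν⁻¹ (negP U'))
      R'U≃R[-ν⁻¹U'] = begin
        mulP R' U                           ≈⟨ ≃-sym (scaleP-identity (mulP R' U)) ⟩
        scaleP 1# (mulP R' U)               ≈⟨ scaleP-cong (sym (trans (*-comm ν⁻¹ ν) (proj₂ (inverse ν n≉0)))) ≃-refl ⟩
        scaleP (ν⁻¹ * ν) (mulP R' U)        ≈⟨ ≃-sym (scaleP-assoc ν⁻¹ ν (mulP R' U)) ⟩
        scaleP ν⁻¹ (scaleP ν (mulP R' U))   ≈⟨ scaleP-cong refl (addP-inverseˡ-unique _ _ G≃[]) ⟩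
        scaleP ν⁻¹ (negP (mulP R U'))       ≈⟨ scaleP-cong refl (negP-distribʳ-mulP R U') ⟩
        scaleP ν⁻¹ (mulP R (negP U'))       ≈⟨ ≃-sym (scaleP-mulPʳ ν⁻¹ R (negP U')) ⟩
        mulP R (scaleP ν⁻¹ (negP U'))       ∎
      R∣U = coprime-∣ R R' U (scaleP ν⁻¹ (negP U')) R⊥R' R'U≃R[-ν⁻¹U']
      U₂ = proj₁ R∣U
      U≃RU₂ = proj₂ R∣U
      RG₂≃[] : mulP R (reducedDeriv (suc n) R U₂) ≃ []
      RG₂≃[] = ≃-trans (≃-sym (reducedDeriv-mulP n R U₂)) (≃-trans (reducedDeriv-cong n R (≃-sym U≃RU₂)) G≃[])

    -- Each descent step divides U by R, so it lowers deg U by deg R and raises n by one.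
    reducedDeriv≄[] : ∀ {u} → Acc _<_ u → ∀ n U → HasDegree U u →
                      (∀ j → j ℕ.* suc D ≤ u → ¬ natR (n ℕ.+ j) ≈ 0#) → ¬ reducedDeriv n R U ≃ []
    reducedDeriv≄[] {u} (acc rec) n U deg-U n+j≉0 G≃[] = descend (reducedDeriv≃[]-descent n U n≉0 G≃[])
      where
      n≉0 : ¬ natR n ≈ 0#
      n≉0 = ≡.subst (λ t → ¬ natR t ≈ 0#) (ℕₚ.+-identityʳ n) (n+j≉0 0 z≤n)
      descend : (Σ Pol λ U₂ → U ≃ mulP R U₂ × reducedDeriv (suc n) R U₂ ≃ []) → ⊥
      descend (U₂ , U≃RU₂ , G₂≃[]) = by-degree (≃[]⊎HasDegree U₂)
        where
        by-degree : U₂ ≃ [] ⊎ ∃ (HasDegree U₂) → ⊥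
        by-degree (inj₁ U₂≃[]) = proj₁ deg-U (at (≃-trans U≃RU₂ (≃-trans (mulP-congʳ R U₂≃[]) (mulP-zeroʳ R))) u)
        by-degree (inj₂ (u₂ , deg-U₂)) = reducedDeriv≄[] (rec u₂<u) (suc n) U₂ deg-U₂ 1+n+j≉0 G₂≃[]
          where
          u≡D+1+u₂ : u ≡ suc D ℕ.+ u₂
          u≡D+1+u₂ = HasDegree-unique {U} deg-U (HasDegree-≃ {mulP R U₂} {U} (≃-sym U≃RU₂) (HasDegree-mulP R U₂ (suc D) u₂ deg-R deg-U₂))
          u₂<u : u₂ < u
          u₂<u = ℕₚ.≤-trans (s≤s (ℕₚ.m≤n+m u₂ D)) (ℕₚ.≤-reflexive (≡.sym u≡D+1+u₂))
          1+n+j≉0 : ∀ j → j ℕ.* suc D ≤ u₂ → ¬ natR (suc n ℕ.+ j) ≈ 0#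
          1+n+j≉0 j j[D+1]≤u₂ = ≡.subst (λ t → ¬ natR t ≈ 0#) (ℕₚ.+-suc n j)
            (n+j≉0 (suc j) (ℕₚ.≤-trans (ℕₚ.+-monoʳ-≤ (suc D) j[D+1]≤u₂) (ℕₚ.≤-reflexive (≡.sym u≡D+1+u₂))))

  module _ (R S : Pol) (m D E : ℕ) (deg-R : HasDegree R (suc D)) (deg-S : HasDegree S (suc E)) (R₀≈1 : coeff R 0 ≈ 1#)
           (contact : DividesP (xPow (suc D ℕ.+ suc E ℕ.+ 1)) (subP (mulP (powP R (suc m)) S) oneP)) where

    G≃[] : reducedDeriv (suc m) R S ≃ []
    G≃[] = contact⇒reducedDeriv≃[] R S m D E R₀≈1 (proj₂ deg-R) (proj₂ deg-S) contact

    contact⇒natR-top≈0 : natR (suc m ℕ.* suc D ℕ.+ suc E) ≈ 0#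
    contact⇒natR-top≈0 = x*y≈0⇒x≈0 (x≉0∧y≉0⇒x*y≉0 (proj₁ deg-R) (proj₁ deg-S))
      (trans (sym (coeff-reducedDeriv-top (suc m) R S D E (proj₂ deg-R) (proj₂ deg-S))) (at G≃[] (D ℕ.+ suc E)))

    contact⇒natR≈0 : CoprimeP R (deriv R) → ¬ (∀ j → j ℕ.* suc D ≤ suc E → ¬ natR (suc m ℕ.+ j) ≈ 0#)
    contact⇒natR≈0 R⊥R' m+j≉0 = reducedDeriv≄[] R deg-R R₀≈1 R⊥R' (<-wellFounded (suc E)) (suc m) S deg-S m+j≉0 G≃[]

module ContactBound {c ℓ : Level} (F : CommutativeRing c ℓ) (isField : IsField F)
  (_≟_ : Decidable (CommutativeRing._≈_ F)) {p : ℕ}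
  (natR≉0 : ∀ N → ¬ p ∣ N → ¬ CommutativeRing._≈_ F (Poly.natR F N) (CommutativeRing.0# F)) where
  open CommutativeRing F hiding (zero)
  open Poly F
  open Characteristic F using (natR-+)
  open PolynomialsOverField F isField _≟_

  no-contact : ∀ R S m D E l → HasDegree R (suc D) → HasDegree S E → 0 < E → coeff R 0 ≈ 1# →
    CoprimeP R (deriv R) → natR (suc m ℕ.* suc D ℕ.+ E ℕ.+ (suc m ℕ.+ l)) ≈ 0# →
    ((∀ j → suc m ≤ j → j ≤ suc m ℕ.+ floorDiv E (suc D) → ¬ p ∣ j) ⊎ ¬ p ∣ (suc m ℕ.+ l)) →
    ¬ DividesP (xPow (suc D ℕ.+ E ℕ.+ 1)) (subP (mulP (powP R (suc m)) S) oneP)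
  no-contact R S m D (suc E) l deg-R deg-S _ R₀≈1 R⊥R' total≈0 (inj₂ p∤m+l) contact =
    natR≉0 (suc m ℕ.+ l) p∤m+l (begin
      natR (suc m ℕ.+ l)                                   ≈⟨ +-identityˡ _ ⟨
      0# + natR (suc m ℕ.+ l)                              ≈⟨ +-congʳ (contact⇒natR-top≈0 R S m D E deg-R deg-S R₀≈1 contact) ⟨
      natR (suc m ℕ.* suc D ℕ.+ suc E) + natR (suc m ℕ.+ l) ≈⟨ natR-+ (suc m ℕ.* suc D ℕ.+ suc E) (suc m ℕ.+ l) ⟨
      natR (suc m ℕ.* suc D ℕ.+ suc E ℕ.+ (suc m ℕ.+ l))     ≈⟨ total≈0 ⟩
      0#                                                   ∎)
    where open SetoidReasoning setoid
  no-contact R S m D (suc E) l deg-R deg-S _ R₀≈1 R⊥R' _ (inj₁ p∤m…m+⌊E/D⌋) contact =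
    contact⇒natR≈0 R S m D E deg-R deg-S R₀≈1 contact R⊥R' λ j j[D+1]≤E →
      natR≉0 (suc m ℕ.+ j) (p∤m…m+⌊E/D⌋ (suc m ℕ.+ j) (ℕₚ.m≤m+n (suc m) j) (ℕₚ.+-monoʳ-≤ (suc m) (j≤⌊E/D⌋ j j[D+1]≤E)))
    where
    j≤⌊E/D⌋ : ∀ j → j ℕ.* suc D ≤ suc E → j ≤ suc E ℕ./ suc D
    j≤⌊E/D⌋ j j[D+1]≤E = ≡.subst (_≤ suc E ℕ./ suc D) (DivMod.m*n/n≡m j (suc D)) (DivMod./-monoˡ-≤ (suc D) j[D+1]≤E)

-- Only from here on: inside the modules above, _+_ and _*_ are the ring operations.
open import Data.Nat using (_+_; _*_; _^_)
open import Data.Nat.Solver using (module +-*-Solver)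

size-split : ∀ q m n k l → k ≡ q ∸ m * suc n → 0 < k → l ≤ k → m * n + (k ∸ l) + (m + l) ≡ q
size-split q m n k l k≡q∸m[n+1] 0<k l≤k = begin
  m * n + (k ∸ l) + (m + l)     ≡⟨ solve 4 (λ a b c d → (a :+ b) :+ (c :+ d) := (c :+ a) :+ (b :+ d)) ≡.refl (m * n) (k ∸ l) m l ⟩
  (m + m * n) + ((k ∸ l) + l)   ≡⟨ ≡.cong₂ _+_ (≡.sym (ℕₚ.*-suc m n)) (ℕₚ.m∸n+n≡m l≤k) ⟩
  m * suc n + k                 ≡⟨ ≡.cong (m * suc n +_) k≡q∸m[n+1] ⟩
  m * suc n + (q ∸ m * suc n)   ≡⟨ ℕₚ.m+[n∸m]≡n (ℕₚ.<⇒≤ (ℕₚ.m∸n≢0⇒n<m {q} {m * suc n} (ℕₚ.n>0⇒n≢0 (≡.subst (0 <_) k≡q∸m[n+1] 0<k)))) ⟩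
  q                             ∎
  where
  open ≡.≡-Reasoning
  open +-*-Solver

lemma3p1 : {c ℓ : Level} (F : CommutativeRing c ℓ) → IsField F →
           (p s q : ℕ) → Prime p → 1 ≤ s → q ≡ p ^ s → HasSize F q →
           let open Poly F in
           (R S : Pol) (m n k l : ℕ) →
           NonConstant R → NonConstant S →
           ConstTermOne R → ConstTermOne S →
           CoprimeP R (deriv R) →
           2 ≤ m → 2 ≤ n →
           k ≡ q ∸ m * n → 0 < k →
           HasDegree R (n ∸ 1) →
           l ≤ k → HasDegree S (k ∸ l) →
           ((∀ j → m ≤ j → j ≤ m + floorDiv (k ∸ l) (n ∸ 1) → ¬ (p ∣ j))
             ⊎ ¬ (p ∣ (m + l))) →
           ¬ DividesP (xPow ((n ∸ 1) + (k ∸ l) + 1)) (subP (mulP (powP R m) S) oneP)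
lemma3p1 F isField p s q p-prime _ q≡pˢ size R S (suc m) (suc (suc d)) k l _ nonconstant-S R₀≈1 _ R⊥R'
         (s≤s _) (s≤s (s≤s _)) k≡q∸mn 0<k deg-R l≤k deg-S conditions =
  no-contact R S m d (k ∸ l) l deg-R deg-S 0<deg-S R₀≈1 R⊥R' total≈0 conditions
  where
  open CommutativeRing F using (_≈_; 0#; trans; reflexive)
  open Poly F using (natR)
  open FiniteCommutativeRing F size using (≈-decidable; natR-size≈0)
  open PolynomialsOverField F isField ≈-decidable using (HasDegree-unique)
  natR≉0 : ∀ N → ¬ p ∣ N → ¬ natR N ≈ 0#
  natR≉0 N = Characteristic.p∤N⇒natR≉0 F p-prime (IsField.1≉0 isField) s (≡.subst (λ t → natR t ≈ 0#) q≡pˢ natR-size≈0)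
  open ContactBound F isField ≈-decidable natR≉0 using (no-contact)
  0<deg-S : 0 < k ∸ l
  0<deg-S = ≡.subst (0 <_) (HasDegree-unique {S} (proj₂ (proj₂ nonconstant-S)) deg-S) (proj₁ (proj₂ nonconstant-S))
  total≈0 : natR (suc m * suc d + (k ∸ l) + (suc m + l)) ≈ 0#
  total≈0 = trans (reflexive (≡.cong natR (size-split q (suc m) (suc d) k l k≡q∸mn 0<k l≤k))) natR-size≈0
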